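{- Let $a>b>0$ be integers. A $\mathrm{LC}(a^1b^2)$ exists if and only if $a\le 2b$.
   Context: A latin cube of order $N$ is an $N\times N\times N$ array on $N$ symbols such that any two cells whose coordinates differ in exactly one position contain different symbols; a subcube is an $m\times m\times m$ subarray (indices in each coordinate from chosen $m$-sets) that is itself a latin cube of order $m$; subcubes are disjoint if they share no index in any coordinate and no symbol. $\mathrm{LC}(a^1b^2)$ denotes a latin cube of order $a+2b$ with pairwise disjoint subcubes of orders $a$, $b$, $b$. -}

module Defs where

open import Data.Nat using (ℕ; _+_; _*_)
open import Data.Fin using (Fin)
open import Data.Product using (Σ; _×_; ∃)
open import Relation.Binary.PropositionalEquality using (_≡_; _≢_)
open import Function.Definitions using (Injective)

Cube : ℕ → Set
Cube n = Fin n → Fin n → Fin n → Fin n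

IsLatinCube : ∀ {n} → Cube n → Set
IsLatinCube {n} L =
    (∀ (i i′ : Fin n) j k → i ≢ i′ → L i j k ≢ L i′ j k)
  × (∀ i (j j′ : Fin n) k → j ≢ j′ → L i j k ≢ L i j′ k)
  × (∀ i j (k k′ : Fin n) → k ≢ k′ → L i j k ≢ L i j k′)

record Subcube {N : ℕ} (L : Cube N) (m : ℕ) : Set where
  field
    rows cols files syms : Fin m → Fin N
    rows-inj  : Injective _≡_ _≡_ rows
    cols-inj  : Injective _≡_ _≡_ cols
    files-inj : Injective _≡_ _≡_ files
    syms-inj  : Injective _≡_ _≡_ syms
    sub       : Cube m
    sub-latin : IsLatinCube sub
    agrees    : ∀ i j k → L (rows i) (cols j) (files k) ≡ syms (sub i j k)
open Subcube public

DisjointImg : ∀ {m m′ N} → (Fin m → Fin N) → (Fin m′ → Fin N) → Set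
DisjointImg f g = ∀ i j → f i ≢ g j

Disjoint : ∀ {N m m′} {L : Cube N} → Subcube L m → Subcube L m′ → Set
Disjoint S T =
    DisjointImg (rows S) (rows T)
  × DisjointImg (cols S) (cols T)
  × DisjointImg (files S) (files T)
  × DisjointImg (syms S) (syms T)

LC-a1b2 : ℕ → ℕ → Set
LC-a1b2 a b =
  Σ (Cube (a + 2 * b)) λ L →
    IsLatinCube L
  × Σ (Subcube L a) λ A → Σ (Subcube L b) λ B₁ → Σ (Subcube L b) λ B₂ →
      Disjoint A B₁ × Disjoint A B₂ × Disjoint B₁ B₂

-- If a subcube A of order a misses a file f, fix a row r of A: the a cells (r, y, f) with y a column
-- of A carry a symbols, none of them a symbol of A, since each symbol of A already occurs in the
-- file-line of A through (r, y). Hence 2a ≤ a + 2b.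
--
-- Conversely, a latin square P of order N gives the latin cube L(x, y, z) = the row v such that y
-- and z stand in a common column of the rows x and v. An n × n subsquare of P on rows R, columns C
-- and symbols S gives a subcube of L on R × S × S; the columns C are not coordinates of L, so two
-- subsquares may share them. It therefore suffices to find a latin square of order a + 2b with a
-- subsquare on ℤ/a and, for each parity, a b × b subsquare on the residues of that parity in ℤ/2b,
-- both living on the same b columns. Writing a = b + c and 2b = a + w, such a square is built from
-- cyclic shifts: row ρ of ℤ/2b uses the even offsets on the b shared columns and the odd offsets
-- on c further columns of ℤ/a and on the w columns r with r − ρ < w.

module Submission where

open import Defs
open import Data.Nat using (ℕ; zero; suc; _+_; _*_; _∸_; _%_; _/_; _<_; _≤_; z≤n; s≤s; NonZero; >-nonZero; >-nonZero⁻¹)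
open import Data.Nat.Properties
open import Data.Nat.Tactic.RingSolver using (solve-∀)
open import Data.Nat.DivMod
open import Data.Nat.Divisibility using (_∣_; divides; ∣-refl)
open import Data.Fin as Fin using (Fin; toℕ; cast; fromℕ<; _↑ˡ_; _↑ʳ_; splitAt; join; punchOut)
open import Data.Fin.Properties
  using (any?; injective⇒≤; punchOut-injective; toℕ-injective; toℕ-fromℕ<; toℕ<n; join-splitAt; splitAt-join; toℕ-cast; toℕ-↑ˡ; toℕ-↑ʳ; splitAt-↑ˡ; splitAt-↑ʳ; ↑ˡ-injective; ↑ʳ-injective)
  renaming (_≟_ to _≟ᶠ_)
open import Data.Product using (_×_; _,_; proj₁; proj₂; ∃)
open import Data.Sum as Sum using (_⊎_; inj₁; inj₂; [_,_]′)
open import Data.Sum.Properties using (inj₁-injective; inj₂-injective)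
open import Data.Empty using (⊥-elim)
open import Relation.Nullary using (yes; no)
open import Relation.Binary.PropositionalEquality
open import Function using (_∘_)
open import Function.Definitions using (Injective)
open import Function.Consequences.Propositional using (inverseʳ⇒injective; strictlyInverseʳ⇒inverseʳ)
open import Function.Bundles using (_⇔_; mk⇔)

injective⇒surjective : ∀ {n} (f : Fin n → Fin n) → Injective _≡_ _≡_ f → ∀ y → ∃ λ x → f x ≡ y
injective⇒surjective {zero} f inj ()
injective⇒surjective {suc n} f inj y with any? (λ x → f x ≟ᶠ y)
... | yes hit = hit
... | no miss = ⊥-elim (<-irrefl refl (injective⇒≤ {f = squeeze} squeeze-injective))
  where
  avoids : ∀ x → y ≢ f x
  avoids x eq = miss (x , sym eq)
  squeeze : Fin (suc n) → Fin n
  squeeze x = punchOut (avoids x)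
  squeeze-injective : Injective _≡_ _≡_ squeeze
  squeeze-injective eq = inj (punchOut-injective (avoids _) (avoids _) eq)

-- Modular arithmetic

module _ {n : ℕ} .{{_ : NonZero n}} where

  [m%n+o]%n≡[m+o]%n : ∀ x t → (x % n + t) % n ≡ (x + t) % n
  [m%n+o]%n≡[m+o]%n x t = begin
    (x % n + t) % n             ≡⟨ %-distribˡ-+ (x % n) t n ⟩
    (x % n % n + t % n) % n     ≡⟨ cong (λ u → (u + t % n) % n) (m%n%n≡m%n x n) ⟩
    (x % n + t % n) % n         ≡⟨ %-distribˡ-+ x t n ⟨
    (x + t) % n                 ∎
    where open ≡-Reasoning

  n∣m+[n∸m%n] : ∀ t → n ∣ t + (n ∸ t % n)
  n∣m+[n∸m%n] t = divides (suc (t / n)) (begin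
    t + (n ∸ t % n)                    ≡⟨ cong (_+ (n ∸ t % n)) (m≡m%n+[m/n]*n t n) ⟩
    t % n + t / n * n + (n ∸ t % n)    ≡⟨ +-assoc (t % n) _ _ ⟩
    t % n + (t / n * n + (n ∸ t % n))  ≡⟨ cong (t % n +_) (+-comm (t / n * n) _) ⟩
    t % n + ((n ∸ t % n) + t / n * n)  ≡⟨ +-assoc (t % n) _ _ ⟨
    t % n + (n ∸ t % n) + t / n * n    ≡⟨ cong (_+ t / n * n) (m+[n∸m]≡n (m%n≤n t n)) ⟩
    suc (t / n) * n                    ∎)
    where open ≡-Reasoning

  -- adding n ∸ t % n undoes a shift by t
  %-cancelʳ-+ : ∀ t x y → (x + t) % n ≡ (y + t) % n → x % n ≡ y % n
  %-cancelʳ-+ t x y eq = begin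
    x % n                            ≡⟨ unshift x ⟩
    ((x + t) % n + (n ∸ t % n)) % n  ≡⟨ cong (λ u → (u + (n ∸ t % n)) % n) eq ⟩
    ((y + t) % n + (n ∸ t % n)) % n  ≡⟨ unshift y ⟨
    y % n                            ∎
    where
    open ≡-Reasoning
    unshift : ∀ z → z % n ≡ ((z + t) % n + (n ∸ t % n)) % n
    unshift z = begin
      z % n                        ≡⟨ %-remove-+ʳ z (n∣m+[n∸m%n] t) ⟨
      (z + (t + (n ∸ t % n))) % n  ≡⟨ cong (_% n) (+-assoc z t _) ⟨
      (z + t + (n ∸ t % n)) % n    ≡⟨ [m%n+o]%n≡[m+o]%n (z + t) _ ⟨
      ((z + t) % n + (n ∸ t % n)) % n ∎

  %-cancelˡ-+ : ∀ t x y → (t + x) % n ≡ (t + y) % n → x % n ≡ y % n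
  %-cancelˡ-+ t x y eq = %-cancelʳ-+ t x y (subst₂ (λ u v → u % n ≡ v % n) (+-comm t x) (+-comm t y) eq)

  toℕ-mod : ∀ x → toℕ (x mod n) ≡ x % n
  toℕ-mod x = toℕ-fromℕ< (m%n<n x n)

  mod-≡⇒%-≡ : ∀ {x y} → x mod n ≡ y mod n → x % n ≡ y % n
  mod-≡⇒%-≡ {x} {y} eq = trans (sym (toℕ-mod x)) (trans (cong toℕ eq) (toℕ-mod y))

  %-≡⇒mod-≡ : ∀ {x y} → x % n ≡ y % n → x mod n ≡ y mod n
  %-≡⇒mod-≡ {x} {y} eq = toℕ-injective (trans (toℕ-mod x) (trans eq (sym (toℕ-mod y))))

  %-injective : ∀ {x y} → x < n → y < n → x % n ≡ y % n → x ≡ y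
  %-injective {x} {y} x<n y<n eq = trans (sym (m<n⇒m%n≡m x<n)) (trans eq (m<n⇒m%n≡m y<n))

  mod-cancelʳ : ∀ t {x y} → x < n → y < n → (x + t) mod n ≡ (y + t) mod n → x ≡ y
  mod-cancelʳ t x<n y<n eq = %-injective x<n y<n (%-cancelʳ-+ t _ _ (mod-≡⇒%-≡ eq))

  mod-cancelˡ : ∀ t {x y} → x < n → y < n → (t + x) mod n ≡ (t + y) mod n → x ≡ y
  mod-cancelˡ t x<n y<n eq = %-injective x<n y<n (%-cancelˡ-+ t _ _ (mod-≡⇒%-≡ eq))

injective-from-≢ : ∀ {n} {B : Set} {f : Fin n → B} → (∀ {x y} → x ≢ y → f x ≢ f y) → Injective _≡_ _≡_ f
injective-from-≢ separates {x} {y} eq with x ≟ᶠ y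
... | yes x≡y = x≡y
... | no x≢y = ⊥-elim (separates x≢y eq)

splitAt-injective : ∀ m {n} → Injective _≡_ _≡_ (splitAt m {n})
splitAt-injective m {n} {x} {y} eq = trans (sym (join-splitAt m n x)) (trans (cong (join m n) eq) (join-splitAt m n y))

join-injective : ∀ m {n} → Injective _≡_ _≡_ (join m n)
join-injective m {n} {s} {t} eq = trans (sym (splitAt-join m n s)) (trans (cong (splitAt m) eq) (splitAt-join m n t))

map-injective : ∀ {A B C D : Set} {f : A → B} {g : C → D} →
  Injective _≡_ _≡_ f → Injective _≡_ _≡_ g → Injective _≡_ _≡_ (Sum.map f g)
map-injective f-inj g-inj {inj₁ _} {inj₁ _} eq = cong inj₁ (f-inj (inj₁-injective eq))
map-injective f-inj g-inj {inj₂ _} {inj₂ _} eq = cong inj₂ (g-inj (inj₂-injective eq))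
map-injective f-inj g-inj {inj₁ _} {inj₂ _} ()
map-injective f-inj g-inj {inj₂ _} {inj₁ _} ()

module _ {N} {L : Cube N} (L-latin : IsLatinCube L) where

  subcube-order-half : ∀ {a} (A : Subcube L a) (f : Fin N) → (∀ k → files A k ≢ f) → a + a ≤ N
  subcube-order-half {zero} A f f∉A = z≤n
  subcube-order-half {a@(suc _)} A f f∉A =
    injective⇒≤ {f = [ syms A , line ]′ ∘ splitAt a} (λ eq → splitAt-injective a (merge-injective eq))
    where
    r : Fin N
    r = rows A Fin.zero
    line : Fin a → Fin N
    line j = L r (cols A j) f
    line-injective : Injective _≡_ _≡_ line
    line-injective = injective-from-≢ λ j≢j′ → proj₁ (proj₂ L-latin) r _ _ f (j≢j′ ∘ cols-inj A)
    line-avoids-A : ∀ s j → syms A s ≢ line j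
    line-avoids-A s j eq with k , s-at-k ← injective⇒surjective (sub A Fin.zero j)
          (injective-from-≢ λ k≢k′ → proj₂ (proj₂ (sub-latin A)) Fin.zero j _ _ k≢k′) s =
      proj₂ (proj₂ L-latin) r (cols A j) (files A k) f (f∉A k)
        (trans (agrees A Fin.zero j k) (trans (cong (syms A) s-at-k) eq))
    merge-injective : Injective _≡_ _≡_ [ syms A , line ]′
    merge-injective {inj₁ s} {inj₁ s′} eq = cong inj₁ (syms-inj A eq)
    merge-injective {inj₁ s} {inj₂ j} eq = ⊥-elim (line-avoids-A s j eq)
    merge-injective {inj₂ j} {inj₁ s} eq = ⊥-elim (line-avoids-A s j (sym eq))
    merge-injective {inj₂ j} {inj₂ j′} eq = cong inj₂ (line-injective eq)

-- Latin squares and the latin cubes they determine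

Square : ℕ → Set
Square n = Fin n → Fin n → Fin n

IsLatinSquare : ∀ {n} → Square n → Set
IsLatinSquare {n} P = (∀ x → Injective _≡_ _≡_ (P x)) × (∀ k → Injective _≡_ _≡_ (λ x → P x k))

module LatinSquare {n} {P : Square n} (P-latin : IsLatinSquare P) where

  private
    row-injective : ∀ x → Injective _≡_ _≡_ (P x)
    row-injective = proj₁ P-latin
    column-injective : ∀ k → Injective _≡_ _≡_ (λ x → P x k)
    column-injective = proj₂ P-latin

  column : Fin n → Fin n → Fin n
  column x y = proj₁ (injective⇒surjective (P x) (row-injective x) y)

  P-column : ∀ x y → P x (column x y) ≡ y
  P-column x y = proj₂ (injective⇒surjective (P x) (row-injective x) y)

  column-unique : ∀ {x y k} → P x k ≡ y → column x y ≡ k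
  column-unique {x} eq = row-injective x (trans (P-column x _) (sym eq))

  row : Fin n → Fin n → Fin n
  row k z = proj₁ (injective⇒surjective (λ x → P x k) (column-injective k) z)

  P-row : ∀ k z → P (row k z) k ≡ z
  P-row k z = proj₂ (injective⇒surjective (λ x → P x k) (column-injective k) z)

  row-unique : ∀ {x k z} → P x k ≡ z → row k z ≡ x
  row-unique {k = k} eq = column-injective k (trans (P-row k _) (sym eq))

  cube : Cube n
  cube x y z = row (column x y) z

  same-column : ∀ {x y x′ y′ z} → cube x y z ≡ cube x′ y′ z → column x y ≡ column x′ y′
  same-column {x} {y} {x′} {y′} {z} eq = row-injective (cube x y z)
    (trans (P-row _ z) (sym (trans (cong (λ v → P v (column x′ y′)) eq) (P-row _ z))))

  cube-latin : IsLatinCube cube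
  cube-latin =
      (λ x x′ y z x≢x′ eq → x≢x′ (column-injective (column x y)
         (trans (P-column x y) (sym (trans (cong (P x′) (same-column {x} {y} {x′} {y} {z} eq)) (P-column x′ y))))))
    , (λ x y y′ z y≢y′ eq → y≢y′
         (trans (sym (P-column x y)) (trans (cong (P x) (same-column {x} {y} {x} {y′} {z} eq)) (P-column x y′))))
    , (λ x y z z′ z≢z′ eq → z≢z′
         (trans (sym (P-row (column x y) z)) (trans (cong (λ v → P v (column x y)) eq) (P-row _ z′))))

record Subsquare {N} (P : Square N) (n : ℕ) : Set where
  field
    rows cols syms : Fin n → Fin N
    rows-inj : Injective _≡_ _≡_ rows
    cols-inj : Injective _≡_ _≡_ cols
    syms-inj : Injective _≡_ _≡_ syms
    sub : Square n
    agrees : ∀ i j → P (rows i) (cols j) ≡ syms (sub i j)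

module _ {N} {P : Square N} where

  Separated : ∀ {m m′} → Subsquare P m → Subsquare P m′ → Set
  Separated S T = DisjointImg (Subsquare.rows S) (Subsquare.rows T) × DisjointImg (Subsquare.syms S) (Subsquare.syms T)

module _ {N} {P : Square N} (P-latin : IsLatinSquare P) where

  open LatinSquare P-latin

  subsquare-latin : ∀ {n} (S : Subsquare P n) → IsLatinSquare (Subsquare.sub S)
  subsquare-latin S =
      (λ i eq → S.cols-inj (proj₁ P-latin (S.rows i) (trans (S.agrees i _) (trans (cong S.syms eq) (sym (S.agrees i _))))))
    , (λ j eq → S.rows-inj (proj₂ P-latin (S.cols j) (trans (S.agrees _ j) (trans (cong S.syms eq) (sym (S.agrees _ j))))))
    where module S = Subsquare S

  subcube : ∀ {n} → Subsquare P n → Subcube cube n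
  subcube S = record
    { rows = S.rows ; cols = S.syms ; files = S.syms ; syms = S.rows
    ; rows-inj = S.rows-inj ; cols-inj = S.syms-inj ; files-inj = S.syms-inj ; syms-inj = S.rows-inj
    ; sub = Sub.cube
    ; sub-latin = Sub.cube-latin
    ; agrees = λ i j l → begin
        cube (S.rows i) (S.syms j) (S.syms l)
          ≡⟨ cong (λ k → row k (S.syms l)) (column-unique (trans (S.agrees i _) (cong S.syms (Sub.P-column i j)))) ⟩
        row (S.cols (Sub.column i j)) (S.syms l)
          ≡⟨ row-unique (trans (S.agrees _ _) (cong S.syms (Sub.P-row _ l))) ⟩
        S.rows (Sub.cube i j l)
          ∎
    }
    where
    module S = Subsquare S
    module Sub = LatinSquare (subsquare-latin S)
    open ≡-Reasoning

  subcube-disjoint : ∀ {m m′} {S : Subsquare P m} {T : Subsquare P m′} → Separated S T → Disjoint (subcube S) (subcube T)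
  subcube-disjoint (rows-disjoint , syms-disjoint) = rows-disjoint , syms-disjoint , syms-disjoint , rows-disjoint

LC-a1b2-from-square : ∀ {a b} {P : Square (a + 2 * b)} (P-latin : IsLatinSquare P)
  (A : Subsquare P a) (B₁ B₂ : Subsquare P b) →
  Separated A B₁ → Separated A B₂ → Separated B₁ B₂ → LC-a1b2 a b
LC-a1b2-from-square P-latin A B₁ B₂ AB₁ AB₂ B₁B₂ =
    LatinSquare.cube P-latin , LatinSquare.cube-latin P-latin
  , subcube P-latin A , subcube P-latin B₁ , subcube P-latin B₂
  , subcube-disjoint P-latin {S = A} {B₁} AB₁ , subcube-disjoint P-latin {S = A} {B₂} AB₂
  , subcube-disjoint P-latin {S = B₁} {B₂} B₁B₂

-- A latin square of order a + 2b for a = b + c ≤ 2b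

module Construction (w c : ℕ) {{_ : NonZero c}} where

  b a m : ℕ
  b = w + c
  a = b + c
  m = 2 * b

  instance
    b-nonZero : NonZero b
    b-nonZero = >-nonZero (<-≤-trans (>-nonZero⁻¹ c) (m≤n+m c w))
    a-nonZero : NonZero a
    a-nonZero = >-nonZero (<-≤-trans (>-nonZero⁻¹ b) (m≤m+n b c))
    m-nonZero : NonZero m
    m-nonZero = m*n≢0 2 b

  m≡w+a : m ≡ w + a
  m≡w+a = identity w c
    where
    identity : ∀ w c → 2 * (w + c) ≡ w + ((w + c) + c)
    identity = solve-∀

  0<2 : 0 < 2
  0<2 = s≤s z≤n

  1<2 : 1 < 2
  1<2 = s≤s (s≤s z≤n)

  parity+2*i<m : ∀ {p i} → p < 2 → i < b → p + 2 * i < m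
  parity+2*i<m {p} {i} p<2 i<b = begin-strict
    p + 2 * i  <⟨ +-monoˡ-< (2 * i) p<2 ⟩
    2 + 2 * i  ≡⟨ *-suc 2 i ⟨
    2 * suc i  ≤⟨ *-monoʳ-≤ 2 i<b ⟩
    m          ∎
    where open ≤-Reasoning

  [p+2*s]%m≡p+2*[s%b] : ∀ {p} s → p < 2 → (p + 2 * s) % m ≡ p + 2 * (s % b)
  [p+2*s]%m≡p+2*[s%b] {p} s p<2 = begin
    (p + 2 * s) % m                           ≡⟨ cong (λ t → (p + 2 * t) % m) (m≡m%n+[m/n]*n s b) ⟩
    (p + 2 * (s % b + s / b * b)) % m         ≡⟨ cong (_% m) (regroup p (s % b) (s / b) b) ⟩
    (p + 2 * (s % b) + s / b * m) % m         ≡⟨ [m+kn]%n≡m%n (p + 2 * (s % b)) (s / b) m ⟩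
    (p + 2 * (s % b)) % m                     ≡⟨ m<n⇒m%n≡m (parity+2*i<m p<2 (m%n<n s b)) ⟩
    p + 2 * (s % b)                           ∎
    where
    open ≡-Reasoning
    regroup : ∀ p r q b → p + 2 * (r + q * b) ≡ p + 2 * r + q * (2 * b)
    regroup = solve-∀

  -- rows and symbols: the block A of order a, then the b even and b odd elements of ℤ/m
  Part : Set
  Part = Fin a ⊎ Fin m

  -- columns: K (order b, the columns of the B-subsquares) and the rest of A, then the block R
  Column : Set
  Column = (Fin b ⊎ Fin c) ⊎ Fin m

  _⊖_ : Fin m → Fin m → Fin m
  r ⊖ ρ = (m ∸ toℕ ρ + toℕ r) mod m

  ⊖-+ : ∀ r ρ → (toℕ (r ⊖ ρ) + toℕ ρ) % m ≡ toℕ r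
  ⊖-+ r ρ = begin
    (toℕ (r ⊖ ρ) + toℕ ρ) % m               ≡⟨ cong (λ t → (t + toℕ ρ) % m) (toℕ-mod (m ∸ toℕ ρ + toℕ r)) ⟩
    ((m ∸ toℕ ρ + toℕ r) % m + toℕ ρ) % m   ≡⟨ [m%n+o]%n≡[m+o]%n (m ∸ toℕ ρ + toℕ r) (toℕ ρ) ⟩
    (m ∸ toℕ ρ + toℕ r + toℕ ρ) % m         ≡⟨ cong (_% m) (+-comm-right (m ∸ toℕ ρ) (toℕ r) (toℕ ρ)) ⟩
    (m ∸ toℕ ρ + toℕ ρ + toℕ r) % m         ≡⟨ cong (λ t → (t + toℕ r) % m) (m∸n+n≡m (<⇒≤ (toℕ<n ρ))) ⟩
    (m + toℕ r) % m                         ≡⟨ %-remove-+ˡ (toℕ r) (∣-refl {m}) ⟩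
    toℕ r % m                               ≡⟨ m<n⇒m%n≡m (toℕ<n r) ⟩
    toℕ r                                   ∎
    where
    open ≡-Reasoning
    +-comm-right : ∀ x y z → x + y + z ≡ x + z + y
    +-comm-right = solve-∀

  gap : Fin m → Fin m → Fin w ⊎ Fin a
  gap ρ r = splitAt w (cast m≡w+a (r ⊖ ρ))

  toℕ-gap : ∀ ρ r → toℕ (r ⊖ ρ) ≡ [ toℕ , (w +_) ∘ toℕ ]′ (gap ρ r)
  toℕ-gap ρ r = begin
    toℕ (r ⊖ ρ)                        ≡⟨ toℕ-cast m≡w+a (r ⊖ ρ) ⟨
    toℕ (cast m≡w+a (r ⊖ ρ))           ≡⟨ cong toℕ (join-splitAt w a _) ⟨
    toℕ (join w a (gap ρ r))           ≡⟨ toℕ-join (gap ρ r) ⟩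
    [ toℕ , (w +_) ∘ toℕ ]′ (gap ρ r)  ∎
    where
    open ≡-Reasoning
    toℕ-join : ∀ s → toℕ (join w a s) ≡ [ toℕ , (w +_) ∘ toℕ ]′ s
    toℕ-join (inj₁ j) = toℕ-↑ˡ j a
    toℕ-join (inj₂ v) = toℕ-↑ʳ w v

  same-gap : ∀ {ρ r ρ′ r′} → gap ρ r ≡ gap ρ′ r′ → toℕ (r ⊖ ρ) ≡ toℕ (r′ ⊖ ρ′)
  same-gap {ρ} {r} {ρ′} {r′} eq = trans (toℕ-gap ρ r) (trans (cong [ toℕ , (w +_) ∘ toℕ ]′ eq) (sym (toℕ-gap ρ′ r′)))

  gap-injectiveʳ : ∀ ρ → Injective _≡_ _≡_ (gap ρ)
  gap-injectiveʳ ρ {r} {r′} eq = toℕ-injective (begin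
    toℕ r                         ≡⟨ ⊖-+ r ρ ⟨
    (toℕ (r ⊖ ρ) + toℕ ρ) % m     ≡⟨ cong (λ t → (t + toℕ ρ) % m) (same-gap {ρ} {r} {ρ} {r′} eq) ⟩
    (toℕ (r′ ⊖ ρ) + toℕ ρ) % m    ≡⟨ ⊖-+ r′ ρ ⟩
    toℕ r′                        ∎)
    where open ≡-Reasoning

  gap-injectiveˡ : ∀ r → Injective _≡_ _≡_ (λ ρ → gap ρ r)
  gap-injectiveˡ r {ρ} {ρ′} eq = toℕ-injective (%-injective (toℕ<n ρ) (toℕ<n ρ′) (%-cancelˡ-+ (toℕ (r ⊖ ρ)) _ _ (begin
    (toℕ (r ⊖ ρ) + toℕ ρ) % m     ≡⟨ ⊖-+ r ρ ⟩
    toℕ r                         ≡⟨ ⊖-+ r ρ′ ⟨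
    (toℕ (r ⊖ ρ′) + toℕ ρ′) % m   ≡⟨ cong (λ t → (t + toℕ ρ′) % m) (same-gap {ρ} {r} {ρ′} {r} eq) ⟨
    (toℕ (r ⊖ ρ) + toℕ ρ′) % m    ∎)))
    where open ≡-Reasoning

  -- inj₁ i stands for the even residue 2i, inj₂ i for the odd residue 2i + 1
  offset : Fin b ⊎ Fin b → ℕ
  offset (inj₁ i) = 0 + 2 * toℕ i
  offset (inj₂ i) = 1 + 2 * toℕ i

  offset<m : ∀ o → offset o < m
  offset<m (inj₁ i) = parity+2*i<m 0<2 (toℕ<n i)
  offset<m (inj₂ i) = parity+2*i<m 1<2 (toℕ<n i)

  offset-injective : Injective _≡_ _≡_ offset
  offset-injective {inj₁ i} {inj₁ i′} eq = cong inj₁ (toℕ-injective (*-cancelˡ-≡ _ _ 2 eq))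
  offset-injective {inj₂ i} {inj₂ i′} eq = cong inj₂ (toℕ-injective (*-cancelˡ-≡ _ _ 2 (suc-injective eq)))
  offset-injective {inj₁ i} {inj₂ i′} eq = ⊥-elim (even≢odd (toℕ i) (toℕ i′) eq)
  offset-injective {inj₂ i} {inj₁ i′} eq = ⊥-elim (even≢odd (toℕ i′) (toℕ i) (sym eq))

  -- What a row of the block B puts in a column: B-symbols at offsets from the row, or an A-symbol
  Entry : Set
  Entry = (Fin b ⊎ Fin b) ⊎ Fin a

  enter : Fin m → Entry → Part
  enter ρ (inj₁ o) = inj₂ ((toℕ ρ + offset o) mod m)
  enter ρ (inj₂ v) = inj₁ v

  enter-injective : ∀ ρ → Injective _≡_ _≡_ (enter ρ)
  enter-injective ρ {inj₁ o} {inj₁ o′} eq =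
    cong inj₁ (offset-injective (mod-cancelˡ (toℕ ρ) (offset<m o) (offset<m o′) (inj₂-injective eq)))
  enter-injective ρ {inj₂ v} {inj₂ v′} eq = cong inj₂ (inj₁-injective eq)
  enter-injective ρ {inj₁ _} {inj₂ _} ()
  enter-injective ρ {inj₂ _} {inj₁ _} ()

  -- Columns of K get the even offsets; the other A-columns and the first w gaps share the odd ones.
  regroup : (Fin b ⊎ Fin c) ⊎ (Fin w ⊎ Fin a) → Entry
  regroup (inj₁ k) = inj₁ (Sum.map₂ (w ↑ʳ_) k)
  regroup (inj₂ (inj₁ j)) = inj₁ (inj₂ (j ↑ˡ c))
  regroup (inj₂ (inj₂ v)) = inj₂ v

  ungroup : Entry → (Fin b ⊎ Fin c) ⊎ (Fin w ⊎ Fin a)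
  ungroup (inj₁ (inj₁ j)) = inj₁ (inj₁ j)
  ungroup (inj₁ (inj₂ i)) = [ inj₂ ∘ inj₁ , inj₁ ∘ inj₂ ]′ (splitAt w i)
  ungroup (inj₂ v) = inj₂ (inj₂ v)

  regroup-injective : Injective _≡_ _≡_ regroup
  regroup-injective = inverseʳ⇒injective {f⁻¹ = ungroup} regroup (strictlyInverseʳ⇒inverseʳ regroup ungroup-regroup)
    where
    ungroup-regroup : ∀ s → ungroup (regroup s) ≡ s
    ungroup-regroup (inj₁ (inj₁ j)) = refl
    ungroup-regroup (inj₁ (inj₂ j)) = cong [ inj₂ ∘ inj₁ , inj₁ ∘ inj₂ ]′ (splitAt-↑ʳ w c j)
    ungroup-regroup (inj₂ (inj₁ j)) = cong [ inj₂ ∘ inj₁ , inj₁ ∘ inj₂ ]′ (splitAt-↑ˡ w j c)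
    ungroup-regroup (inj₂ (inj₂ v)) = refl

  -- In column r of R the rows of B give the symbols r + 1 + j (j < w) and the rows of A the rest.
  Q : Part → Column → Part
  Q (inj₁ x) (inj₁ k) = inj₁ ((toℕ x + toℕ (join b c k)) mod a)
  Q (inj₁ x) (inj₂ r) = inj₂ ((toℕ r + suc (w + toℕ x)) mod m)
  Q (inj₂ ρ) k = enter ρ (regroup (Sum.map₂ (gap ρ) k))

  w<m : w < m
  w<m = subst (w <_) (sym m≡w+a) (m<m+n w (>-nonZero⁻¹ a))

  w+x<m : ∀ (x : Fin a) → w + toℕ x < m
  w+x<m x = subst (w + toℕ x <_) (sym m≡w+a) (+-monoʳ-< w (toℕ<n x))

  shifted-cancel : ∀ (r : Fin m) {u v} → u < m → v < m → (toℕ r + suc u) mod m ≡ (toℕ r + suc v) mod m → u ≡ v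
  shifted-cancel r u<m v<m eq =
    %-injective u<m v<m (%-cancelˡ-+ {m} 1 _ _ (%-cancelˡ-+ (toℕ r) _ _ (mod-≡⇒%-≡ eq)))

  -- In column r the row ρ of B has the gap j = r - ρ, and the odd offset 2j + 1 puts the symbol r + j + 1 there.
  R-column : Fin m → Fin w ⊎ Fin a → Part
  R-column r = [ (λ j → inj₂ ((toℕ r + suc (toℕ j)) mod m)) , inj₁ ]′

  R-column-injective : ∀ r → Injective _≡_ _≡_ (R-column r)
  R-column-injective r {inj₁ j} {inj₁ j′} eq =
    cong inj₁ (toℕ-injective (shifted-cancel r (<-trans (toℕ<n j) w<m) (<-trans (toℕ<n j′) w<m) (inj₂-injective eq)))
  R-column-injective r {inj₂ v} {inj₂ v′} eq = cong inj₂ (inj₁-injective eq)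
  R-column-injective r {inj₁ _} {inj₂ _} ()
  R-column-injective r {inj₂ _} {inj₁ _} ()

  Q-B-R : ∀ ρ r → Q (inj₂ ρ) (inj₂ r) ≡ R-column r (gap ρ r)
  Q-B-R ρ r = entry (gap ρ r) (toℕ-gap ρ r)
    where
    entry : ∀ s → toℕ (r ⊖ ρ) ≡ [ toℕ , (w +_) ∘ toℕ ]′ s → enter ρ (regroup (inj₂ s)) ≡ R-column r s
    entry (inj₂ v) _ = refl
    entry (inj₁ j) d≡j = cong inj₂ (%-≡⇒mod-≡ (begin
      (toℕ ρ + (1 + 2 * toℕ (j ↑ˡ c))) % m  ≡⟨ cong (λ t → (toℕ ρ + (1 + 2 * t)) % m) (toℕ-↑ˡ j c) ⟩
      (toℕ ρ + (1 + 2 * toℕ j)) % m         ≡⟨ cong (_% m) (identity (toℕ ρ) (toℕ j)) ⟩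
      (toℕ j + toℕ ρ + suc (toℕ j)) % m     ≡⟨ [m%n+o]%n≡[m+o]%n (toℕ j + toℕ ρ) _ ⟨
      ((toℕ j + toℕ ρ) % m + suc (toℕ j)) % m ≡⟨ cong (λ t → ((t + toℕ ρ) % m + suc (toℕ j)) % m) d≡j ⟨
      ((toℕ (r ⊖ ρ) + toℕ ρ) % m + suc (toℕ j)) % m ≡⟨ cong (λ t → (t + suc (toℕ j)) % m) (⊖-+ r ρ) ⟩
      (toℕ r + suc (toℕ j)) % m             ∎))
      where
      open ≡-Reasoning
      identity : ∀ ρ j → ρ + (1 + 2 * j) ≡ j + ρ + suc j
      identity = solve-∀

  A-avoids-B-in-R : ∀ x ρ r → Q (inj₁ x) (inj₂ r) ≢ Q (inj₂ ρ) (inj₂ r)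
  A-avoids-B-in-R x ρ r eq = avoids (gap ρ r) (trans eq (Q-B-R ρ r))
    where
    avoids : ∀ s → Q (inj₁ x) (inj₂ r) ≢ R-column r s
    avoids (inj₁ j) eq = <⇒≱ (toℕ<n j)
      (≤-trans (m≤m+n w (toℕ x)) (≤-reflexive (shifted-cancel r (w+x<m x) (<-trans (toℕ<n j) w<m) (inj₂-injective eq))))
    avoids (inj₂ v) ()

  Q-row-injective : ∀ x → Injective _≡_ _≡_ (Q x)
  Q-row-injective (inj₁ x) {inj₁ k} {inj₁ k′} eq =
    cong inj₁ (join-injective b (toℕ-injective (mod-cancelˡ (toℕ x) (toℕ<n _) (toℕ<n _) (inj₁-injective eq))))
  Q-row-injective (inj₁ x) {inj₂ r} {inj₂ r′} eq =
    cong inj₂ (toℕ-injective (mod-cancelʳ _ (toℕ<n r) (toℕ<n r′) (inj₂-injective eq)))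
  Q-row-injective (inj₁ x) {inj₁ _} {inj₂ _} ()
  Q-row-injective (inj₁ x) {inj₂ _} {inj₁ _} ()
  Q-row-injective (inj₂ ρ) eq = map-injective (λ eq → eq) (gap-injectiveʳ ρ) (regroup-injective (enter-injective ρ eq))

  Q-column-injective : ∀ k → Injective _≡_ _≡_ (λ x → Q x k)
  Q-column-injective (inj₁ k) {inj₁ x} {inj₁ x′} eq =
    cong inj₁ (toℕ-injective (mod-cancelʳ _ (toℕ<n x) (toℕ<n x′) (inj₁-injective eq)))
  Q-column-injective (inj₁ k) {inj₂ ρ} {inj₂ ρ′} eq =
    cong inj₂ (toℕ-injective (mod-cancelʳ _ (toℕ<n ρ) (toℕ<n ρ′) (inj₂-injective eq)))
  Q-column-injective (inj₁ k) {inj₁ _} {inj₂ _} ()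
  Q-column-injective (inj₁ k) {inj₂ _} {inj₁ _} ()
  Q-column-injective (inj₂ r) {inj₁ x} {inj₁ x′} eq =
    cong inj₁ (toℕ-injective (+-cancelˡ-≡ w _ _ (shifted-cancel r (w+x<m x) (w+x<m x′) (inj₂-injective eq))))
  Q-column-injective (inj₂ r) {inj₂ ρ} {inj₂ ρ′} eq =
    cong inj₂ (gap-injectiveˡ r (R-column-injective r (trans (sym (Q-B-R ρ r)) (trans eq (Q-B-R ρ′ r)))))
  Q-column-injective (inj₂ r) {inj₁ x} {inj₂ ρ} eq = ⊥-elim (A-avoids-B-in-R x ρ r eq)
  Q-column-injective (inj₂ r) {inj₂ ρ} {inj₁ x} eq = ⊥-elim (A-avoids-B-in-R x ρ r (sym eq))

  splitColumn : Fin (a + m) → Column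
  splitColumn k = Sum.map₁ (splitAt b) (splitAt a k)

  P : Square (a + m)
  P x k = join a m (Q (splitAt a x) (splitColumn k))

  P-latin : IsLatinSquare P
  P-latin =
      (λ x eq → splitAt-injective a (map-injective (splitAt-injective b) (λ eq → eq)
                  (Q-row-injective (splitAt a x) (join-injective a eq))))
    , (λ k eq → splitAt-injective a (Q-column-injective (splitColumn k) (join-injective a eq)))

  A : Subsquare P a
  A = record
    { rows = _↑ˡ m ; cols = _↑ˡ m ; syms = _↑ˡ m
    ; rows-inj = ↑ˡ-injective m _ _ ; cols-inj = ↑ˡ-injective m _ _ ; syms-inj = ↑ˡ-injective m _ _
    ; sub = λ i j → (toℕ i + toℕ j) mod a
    ; agrees = P-cyclic
    }
    where
    P-cyclic : ∀ i j → P (i ↑ˡ m) (j ↑ˡ m) ≡ ((toℕ i + toℕ j) mod a) ↑ˡ m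
    P-cyclic i j rewrite splitAt-↑ˡ a i m | splitAt-↑ˡ a j m | join-splitAt b c j = refl

  half : ∀ {p} → p < 2 → Fin b → Fin m
  half p<2 i = fromℕ< (parity+2*i<m p<2 (toℕ<n i))

  toℕ-half : ∀ {p} (p<2 : p < 2) i → toℕ (half p<2 i) ≡ p + 2 * toℕ i
  toℕ-half p<2 i = toℕ-fromℕ< (parity+2*i<m p<2 (toℕ<n i))

  -- the residues of parity p, as a subsquare on the columns K
  B : ∀ {p} → p < 2 → Subsquare P b
  B {p} p<2 = record
    { rows = embed ; cols = λ j → (j ↑ˡ c) ↑ˡ m ; syms = embed
    ; rows-inj = embed-injective ; syms-inj = embed-injective
    ; cols-inj = λ eq → ↑ˡ-injective c _ _ (↑ˡ-injective m _ _ eq)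
    ; sub = λ i j → (toℕ i + toℕ j) mod b
    ; agrees = P-cyclic
    }
    where
    embed : Fin b → Fin (a + m)
    embed i = a ↑ʳ half p<2 i
    embed-injective : Injective _≡_ _≡_ embed
    embed-injective {i} {i′} eq = toℕ-injective (*-cancelˡ-≡ _ _ 2 (+-cancelˡ-≡ p _ _
      (trans (sym (toℕ-half p<2 i)) (trans (cong toℕ (↑ʳ-injective a _ _ eq)) (toℕ-half p<2 i′)))))
    P-cyclic : ∀ i j → P (embed i) ((j ↑ˡ c) ↑ˡ m) ≡ embed ((toℕ i + toℕ j) mod b)
    P-cyclic i j rewrite splitAt-↑ʳ a m (half p<2 i) | splitAt-↑ˡ a (j ↑ˡ c) m | splitAt-↑ˡ b j c =
      cong (a ↑ʳ_) (toℕ-injective (begin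
        toℕ ((toℕ (half p<2 i) + (0 + 2 * toℕ j)) mod m) ≡⟨ toℕ-mod _ ⟩
        (toℕ (half p<2 i) + (0 + 2 * toℕ j)) % m  ≡⟨ cong (λ t → (t + 2 * toℕ j) % m) (toℕ-half p<2 i) ⟩
        (p + 2 * toℕ i + 2 * toℕ j) % m           ≡⟨ cong (_% m) (identity p (toℕ i) (toℕ j)) ⟩
        (p + 2 * (toℕ i + toℕ j)) % m             ≡⟨ [p+2*s]%m≡p+2*[s%b] (toℕ i + toℕ j) p<2 ⟩
        p + 2 * ((toℕ i + toℕ j) % b)             ≡⟨ cong (λ t → p + 2 * t) (toℕ-mod (toℕ i + toℕ j)) ⟨
        p + 2 * toℕ ((toℕ i + toℕ j) mod b)       ≡⟨ toℕ-half p<2 ((toℕ i + toℕ j) mod b) ⟨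
        toℕ (half p<2 ((toℕ i + toℕ j) mod b))    ∎))
      where
      open ≡-Reasoning
      identity : ∀ p i j → p + 2 * i + 2 * j ≡ p + 2 * (i + j)
      identity = solve-∀

  B₀ B₁ : Subsquare P b
  B₀ = B 0<2
  B₁ = B 1<2

  A-B-separated : ∀ {p} (p<2 : p < 2) → Separated A (B p<2)
  A-B-separated p<2 = apart , apart
    where
    apart : ∀ i j → i ↑ˡ m ≢ a ↑ʳ half p<2 j
    apart i j eq with () ← trans (sym (splitAt-↑ˡ a i m)) (trans (cong (splitAt a) eq) (splitAt-↑ʳ a m (half p<2 j)))

  B₀-B₁-separated : Separated B₀ B₁
  B₀-B₁-separated = apart , apart
    where
    apart : ∀ i j → a ↑ʳ half 0<2 i ≢ a ↑ʳ half 1<2 j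
    apart i j eq = even≢odd (toℕ i) (toℕ j)
      (trans (sym (toℕ-half 0<2 i)) (trans (cong toℕ (↑ʳ-injective a _ _ eq)) (toℕ-half 1<2 j)))

  LC : LC-a1b2 a b
  LC = LC-a1b2-from-square P-latin A B₀ B₁ (A-B-separated 0<2) (A-B-separated 1<2) B₀-B₁-separated

necessity : ∀ {a b} → 0 < b → LC-a1b2 a b → a ≤ 2 * b
necessity {a} {b} 0<b (L , L-latin , A , B₁ , _ , (_ , _ , files-disjoint , _) , _) =
  +-cancelˡ-≤ a a (2 * b) (subcube-order-half L-latin A (files B₁ f₀) (λ k → files-disjoint k f₀))
  where
  f₀ : Fin b
  f₀ = fromℕ< 0<b

sufficiency : ∀ {a b} → b < a → a ≤ 2 * b → LC-a1b2 a b
sufficiency {a} {b} b<a a≤2b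
  with c′ , b+1+c′≡a ← m≤n⇒∃[o]m+o≡n b<a | w , a+w≡2b ← m≤n⇒∃[o]m+o≡n a≤2b =
  subst₂ LC-a1b2 w+c+c≡a w+c≡b (Construction.LC w (suc c′))
  where
  open ≡-Reasoning
  w+c≡b : w + suc c′ ≡ b
  w+c≡b = +-cancelˡ-≡ b _ _ (begin
    b + (w + suc c′)  ≡⟨ identity b w c′ ⟩
    suc b + c′ + w    ≡⟨ cong (_+ w) b+1+c′≡a ⟩
    a + w             ≡⟨ a+w≡2b ⟩
    2 * b             ≡⟨ cong (b +_) (+-identityʳ b) ⟩
    b + b             ∎)
    where
    identity : ∀ b w c′ → b + (w + suc c′) ≡ suc b + c′ + w
    identity = solve-∀
  w+c+c≡a : w + suc c′ + suc c′ ≡ a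
  w+c+c≡a = trans (cong (_+ suc c′) w+c≡b) (trans (+-suc b c′) b+1+c′≡a)

lemma14 : (a b : ℕ) → 0 < b → b < a → LC-a1b2 a b ⇔ (a ≤ 2 * b)
lemma14 a b 0<b b<a = mk⇔ (necessity 0<b) (sufficiency b<a)
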